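{- In the setting below, let $p$ be a probability on the finite Boolean algebra $\mathcal{B}$ and define for $k\in\{i,j,(i,j)\}$ and $\phi\in L$: $m_k(\phi)=p(\phi^{(k)})$ and $\mathrm{Bel}_k(\phi)=p(\Box_k\phi)$. Then for every $\phi\in L$: $\mathrm{Bel}_k(\phi)=\sum_{\psi\in L:\psi\subset\phi}m_k(\psi)$, $m_k(\phi)=\mathrm{Bel}_k(\phi)-\sum_{\psi\in L:\psi\subsetneq\phi}m_k(\psi)$, and $$m_{i,j}(\phi)=\sum_{\eta,\xi\in L:\ \eta\wedge\xi=\phi}p\bigl(\eta^{(i)}\wedge\xi^{(j)}\bigr).$$
   Context: Setting: $\Theta$ is a finite set of atomic propositions, $\mathcal{B}_0$ a Boolean algebra generated by $\Theta$, $L\subset\mathcal{B}_0$ the smallest subset containing $\Theta\cup\{\bot,\top\}$ and closed under $\wedge,\vee$, and $\mathcal{B}\supset\mathcal{B}_0$ a finite Boolean algebra. Maps $\Box_i,\Box_j,\Box_{i,j}:\mathcal{B}_0\to\mathcal{B}$ each satisfy (m.i) $\Box\top=\top$ and (m.ii) $\Box(\neg\phi\vee\psi)\subset(\neg\Box\phi\vee\Box\psi)$ for all $\phi,\psi\in\mathcal{B}_0$; moreover (m.iv) $\Box_i\phi\subset\Box_{i,j}\phi$, $\Box_j\phi\subset\Box_{i,j}\phi$ and (m.indep) $\Box_{i,j}\phi\subset(\Box_i\phi\vee\Box_j\phi)$ for all $\phi\in\mathcal{B}_0$. Here $\phi\subset\psi$ means $\phi\wedge\psi=\phi$ and $\phi\subsetneq\psi$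 means $\phi\subset\psi$, $\phi\ne\psi$. For $k\in\{i,j,(i,j)\}$ and $\phi\in L$, $\phi^{(k)}=\Box_k\phi\wedge\neg\bigl(\bigvee_{\psi\in L:\psi\subsetneq\phi}\Box_k\psi\bigr)$. -}

module Defs where

open import Level using (Level; _⊔_)
open import Data.Nat using (ℕ; zero; suc)
open import Data.Fin using (Fin)
open import Data.Bool using (Bool; true; false)
open import Data.Bool.Properties using () renaming (_≟_ to _≟ᵇ_)
open import Data.Vec using (Vec; []; _∷_)
open import Data.Vec.Properties using (≡-dec)
open import Data.List using (List; []; _∷_; map; foldr; filter; cartesianProduct; _++_)
open import Data.Product using (_×_; _,_; proj₁; proj₂)
open import Data.Fin.Subset using (Subset; ⊥; ⊤; ∁; _∩_; _∪_; _⊆_; _⊂_)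
open import Data.Fin.Subset.Properties using (_⊆?_; _⊂?_)
open import Relation.Nullary using (Dec; _×-dec_)
open import Relation.Unary using (Decidable)
open import Relation.Binary.Definitions using (DecidableEquality)
open import Relation.Binary.PropositionalEquality using (_≡_)
open import Algebra.Bundles using (CommutativeRing)

-- The finite Boolean algebra B is modelled as the powerset algebra
-- Subset N of its N atoms (every finite Boolean algebra is of this form).
-- Order φ ⊂ ψ of the paper (φ ∧ ψ = φ) is stdlib's _⊆_ ; the paper's
-- strict φ ⊊ ψ is stdlib's _⊂_ (which is ⊆ and ≠).

allSubsets : (n : ℕ) → List (Subset n)
allSubsets zero    = [] ∷ []
allSubsets (suc n) = map (true ∷_) (allSubsets n) ++ map (false ∷_) (allSubsets n)

_≟ˢ_ : {n : ℕ} → DecidableEquality (Subset n)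
_≟ˢ_ = ≡-dec _≟ᵇ_

data InB0 {N t : ℕ} (θ : Fin t → Subset N) : Subset N → Set where
  gen  : (a : Fin t) → InB0 θ (θ a)
  bot  : InB0 θ ⊥
  top  : InB0 θ ⊤
  neg  : {x : Subset N} → InB0 θ x → InB0 θ (∁ x)
  meet : {x y : Subset N} → InB0 θ x → InB0 θ y → InB0 θ (x ∩ y)
  join : {x y : Subset N} → InB0 θ x → InB0 θ y → InB0 θ (x ∪ y)

data InL {N t : ℕ} (θ : Fin t → Subset N) : Subset N → Set where
  gen  : (a : Fin t) → InL θ (θ a)
  bot  : InL θ ⊥
  top  : InL θ ⊤
  meet : {x y : Subset N} → InL θ x → InL θ y → InL θ (x ∩ y)
  join : {x y : Subset N} → InL θ x → InL θ y → InL θ (x ∪ y)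

-- A map □ : B0 → B (represented as a function on B whose values outside
-- B0 are irrelevant) satisfying (m.i) and (m.ii).
record IsBox {N t : ℕ} (θ : Fin t → Subset N) (□ : Subset N → Subset N) : Set where
  field
    m-i  : □ ⊤ ≡ ⊤
    m-ii : (φ ψ : Subset N) → InB0 θ φ → InB0 θ ψ →
           □ (∁ φ ∪ ψ) ⊆ (∁ (□ φ) ∪ □ ψ)

data Agent : Set where
  i j ij : Agent

-- probability on B with values in a commutative ring R
-- (with an order _≤_ for nonnegativity; instantiate R with the reals)
record IsProbability {c ℓ ℓ' : Level} (R : CommutativeRing c ℓ)
         (_≤_ : CommutativeRing.Carrier R → CommutativeRing.Carrier R → Set ℓ')
         {N : ℕ} (p : Subset N → CommutativeRing.Carrier R) : Set (c ⊔ ℓ ⊔ ℓ') where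
  open CommutativeRing R
  field
    nonneg   : (x : Subset N) → 0# ≤ p x
    normed   : p ⊤ ≈ 1#
    additive : (x y : Subset N) → x ∩ y ≡ ⊥ → p (x ∪ y) ≈ p x + p y

sumR : {c ℓ : Level} (R : CommutativeRing c ℓ) {A : Set} →
       (A → CommutativeRing.Carrier R) → List A → CommutativeRing.Carrier R
sumR R f xs = foldr _+_ 0# (map f xs)
  where open CommutativeRing R

module _ {N t : ℕ} (θ : Fin t → Subset N) (decL : Decidable (InL θ)) where

  Lbelow : Subset N → List (Subset N)
  Lbelow φ = filter (λ ψ → decL ψ ×-dec (ψ ⊆? φ)) (allSubsets N)

  LstrictBelow : Subset N → List (Subset N)
  LstrictBelow φ = filter (λ ψ → decL ψ ×-dec (ψ ⊂? φ)) (allSubsets N)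

  Lpairs : Subset N → List (Subset N × Subset N)
  Lpairs φ = filter (λ q → decL (proj₁ q) ×-dec (decL (proj₂ q) ×-dec ((proj₁ q ∩ proj₂ q) ≟ˢ φ)))
                    (cartesianProduct (allSubsets N) (allSubsets N))

  focal : (Subset N → Subset N) → Subset N → Subset N
  focal □ φ = □ φ ∩ ∁ (foldr _∪_ ⊥ (map □ (LstrictBelow φ)))

  module _ {c ℓ : Level} (R : CommutativeRing c ℓ) (p : Subset N → CommutativeRing.Carrier R) where
    mass : (Subset N → Subset N) → Subset N → CommutativeRing.Carrier R
    mass □ φ = p (focal □ φ)

    Bel : (Subset N → Subset N) → Subset N → CommutativeRing.Carrier R
    Bel □ φ = p (□ φ)

{-# OPTIONS --safe #-}

-- For an atom x of B let strongest x be the meet of all ψ ∈ L with x ∈ □ψ.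
-- By (m.i) and (m.ii), □ is monotone and preserves ⊤ and binary meets on B0,
-- so strongest x lies in L and x ∈ □(strongest x).  Consequently x lies in the
-- focal set φ^(□) of φ ∈ L exactly when φ = strongest x: the focal sets of the
-- elements of L below φ partition □φ, and finite additivity of p (the only
-- property of p that is used) gives the first two identities.  For the joint
-- modality, (m.iv) and (m.indep) give strongest_{i,j} x = strongest_i x ∧
-- strongest_j x, so φ^(i,j) is partitioned by the sets η^(i) ∧ ξ^(j) with η ∧ ξ = φ.

module Submission where

open import Defs
open import Level using (Level)
open import Data.Nat using (ℕ; zero; suc)
open import Data.Fin using (Fin)
open import Data.Bool using (true; false)
open import Data.Vec using ([]; _∷_)
open import Data.Product using (_×_; _,_; proj₁; proj₂; ∃)
open import Data.Sum using (_⊎_; inj₁; inj₂)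
open import Data.List using (List; []; _∷_; map; filter)
open import Data.List.Membership.Propositional using () renaming (_∈_ to _∈ˡ_)
open import Data.List.Membership.Propositional.Properties
  using (∈-map⁺; ∈-map⁻; ∈-++⁺ˡ; ∈-++⁺ʳ; ∈-filter⁺; ∈-filter⁻; ∈-cartesianProduct⁺)
open import Data.List.Relation.Unary.Any using (here; there)
open import Data.List.Relation.Unary.All as All using (All)
open import Data.List.Relation.Unary.All.Properties using (all-filter)
open import Data.List.Relation.Unary.AllPairs using ([]; _∷_)
open import Data.List.Relation.Unary.Unique.Propositional using (Unique)
import Data.List.Relation.Unary.Unique.Propositional.Properties as Unique
open import Data.Fin.Subset using (Subset; _∩_; _∪_; _⊆_; _⊂_; _∈_; _∉_; ∁; ⊥; ⊤; ⋃; ⋂)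
open import Data.Fin.Subset.Properties
  using (⊆-refl; ⊆-antisym; ⊆⊤; ∈⊤; ∉⊥; ⊂-irref; p⊂q⇒p⊆q; ⊂-⊆-trans; Empty-unique; ∪-idem; ∩-idem;
         _∈?_; _⊂?_; p∩q⊆p; p∩q⊆q; x∈p∩q⁺; x∈p∩q⁻; x∈p∪q⁺; x∈p∪q⁻; x∉p⇒x∈∁p; x∈∁p⇒x∉p)
open import Relation.Unary using (Decidable)
open import Relation.Binary.PropositionalEquality using (_≡_; refl; sym; trans; cong; cong₂; subst)
open import Relation.Nullary using (¬_; yes; no; _×-dec_; contradiction)
open import Function using (_∘_; _⇔_; mk⇔; Equivalence)
open import Algebra.Bundles using (CommutativeRing)

open Equivalence using (to; from)

private
  variable
    A : Set
    a : A
    as : List A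
    n : ℕ
    x : Fin n
    p q φ ψ : Subset n
    ps : List (Subset n)

allSubsets-complete : (s : Subset n) → s ∈ˡ allSubsets n
allSubsets-complete []                = here refl
allSubsets-complete {suc n} (true ∷ s)  = ∈-++⁺ˡ (∈-map⁺ (true ∷_) (allSubsets-complete s))
allSubsets-complete {suc n} (false ∷ s) =
  ∈-++⁺ʳ (map (true ∷_) (allSubsets n)) (∈-map⁺ (false ∷_) (allSubsets-complete s))

allSubsets-unique : (n : ℕ) → Unique (allSubsets n)
allSubsets-unique zero    = All.[] ∷ []
allSubsets-unique (suc n) =
  Unique.++⁺ (Unique.map⁺ ∷-injectiveʳ (allSubsets-unique n))
             (Unique.map⁺ ∷-injectiveʳ (allSubsets-unique n))
             heads-differ
  where
  ∷-injectiveʳ : ∀ {b} {s s′ : Subset n} → _≡_ {A = Subset (suc n)} (b ∷ s) (b ∷ s′) → s ≡ s′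
  ∷-injectiveʳ refl = refl
  heads-differ : ∀ {v} → ¬ (v ∈ˡ map (true ∷_) (allSubsets n) × v ∈ˡ map (false ∷_) (allSubsets n))
  heads-differ (v∈ , v∈′) with ∈-map⁻ (true ∷_) v∈ | ∈-map⁻ (false ∷_) v∈′
  ... | _ , _ , refl | _ , _ , ()

⊆⇒⊂⊎≡ : p ⊆ q → p ⊂ q ⊎ p ≡ q
⊆⇒⊂⊎≡ {p = p} {q} p⊆q with p ⊂? q
... | yes p⊂q = inj₁ p⊂q
... | no  p⊄q = inj₂ (⊆-antisym p⊆q q⊆p)
  where
  q⊆p : q ⊆ p
  q⊆p {y} y∈q with y ∈? p
  ... | yes y∈p = y∈p
  ... | no  y∉p = contradiction ((λ {_} → p⊆q) , y , y∈q , y∉p) p⊄q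

x∈⋃-map⁺ : {f : A → Subset n} → a ∈ˡ as → x ∈ f a → x ∈ ⋃ (map f as)
x∈⋃-map⁺ (here refl)  x∈fa = x∈p∪q⁺ (inj₁ x∈fa)
x∈⋃-map⁺ (there a∈as) x∈fa = x∈p∪q⁺ (inj₂ (x∈⋃-map⁺ a∈as x∈fa))

x∈⋃-map⁻ : (f : A → Subset n) (as : List A) → x ∈ ⋃ (map f as) → ∃ λ a → a ∈ˡ as × x ∈ f a
x∈⋃-map⁻ f []       x∈⊥ = contradiction x∈⊥ ∉⊥
x∈⋃-map⁻ f (a ∷ as) x∈∪ with x∈p∪q⁻ (f a) (⋃ (map f as)) x∈∪
... | inj₁ x∈fa = a , here refl , x∈fa
... | inj₂ x∈⋃  with x∈⋃-map⁻ f as x∈⋃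
...   | b , b∈as , x∈fb = b , there b∈as , x∈fb

∈-filter⇔ : {P : A → Set} (P? : Decidable P) → (∀ b → b ∈ˡ as) → a ∈ˡ filter P? as ⇔ P a
∈-filter⇔ {as = as} P? complete = mk⇔ (proj₂ ∘ ∈-filter⁻ P? {xs = as}) (∈-filter⁺ P? (complete _))

⋂⊆ : p ∈ˡ ps → ⋂ ps ⊆ p
⋂⊆ {ps = p ∷ ps} (here refl) = p∩q⊆p p (⋂ ps)
⋂⊆ {ps = p ∷ ps} (there p∈ps) = ⋂⊆ p∈ps ∘ p∩q⊆q p (⋂ ps)

x∈∁p∪q : (x ∈ p → x ∈ q) → x ∈ ∁ p ∪ q
x∈∁p∪q {x = x} {p = p} x∈p⇒x∈q with x ∈? p
... | yes x∈p = x∈p∪q⁺ (inj₂ (x∈p⇒x∈q x∈p))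
... | no  x∉p = x∈p∪q⁺ (inj₁ (x∉p⇒x∈∁p x∉p))

IsAdditive : {c ℓ : Level} (R : CommutativeRing c ℓ) {N : ℕ} →
             (Subset N → CommutativeRing.Carrier R) → Set ℓ
IsAdditive R {N} μ = (p q : Subset N) → p ∩ q ≡ ⊥ → μ (p ∪ q) ≈ μ p + μ q
  where open CommutativeRing R

module AdditiveProperties {c ℓ : Level} (R : CommutativeRing c ℓ) {N : ℕ}
  {μ : Subset N → CommutativeRing.Carrier R} (additive : IsAdditive R μ) where
  open CommutativeRing R hiding (refl; sym; trans)
  open import Algebra.Properties.Ring ring using (+-identityʳ-unique)
  open import Relation.Binary.Reasoning.Setoid setoid

  μ⊥≈0 : μ ⊥ ≈ 0#
  μ⊥≈0 = +-identityʳ-unique (μ ⊥) (μ ⊥) (begin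
    μ ⊥ + μ ⊥  ≈⟨ additive ⊥ ⊥ (∩-idem ⊥) ⟨
    μ (⊥ ∪ ⊥)  ≡⟨ cong μ (∪-idem ⊥) ⟩
    μ ⊥        ∎)

  μ-⋃-disjoint : (f : A → Subset N) (as : List A) → Unique as →
    (∀ {a b} {y : Fin N} → a ∈ˡ as → b ∈ˡ as → y ∈ f a → y ∈ f b → a ≡ b) →
    μ (⋃ (map f as)) ≈ sumR R (μ ∘ f) as
  μ-⋃-disjoint f []       _             _        = μ⊥≈0
  μ-⋃-disjoint f (a ∷ as) (a∉as ∷ uniq) disjoint = begin
    μ (f a ∪ ⋃ (map f as))       ≈⟨ additive (f a) (⋃ (map f as)) (Empty-unique noCommonPoint) ⟩
    μ (f a) + μ (⋃ (map f as))   ≈⟨ +-congˡ (μ-⋃-disjoint f as uniq disjoint′) ⟩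
    μ (f a) + sumR R (μ ∘ f) as  ∎
    where
    disjoint′ : ∀ {b b′} {y : Fin N} → b ∈ˡ as → b′ ∈ˡ as → y ∈ f b → y ∈ f b′ → b ≡ b′
    disjoint′ b∈ b′∈ = disjoint (there b∈) (there b′∈)
    noCommonPoint : ¬ ∃ (_∈ f a ∩ ⋃ (map f as))
    noCommonPoint (y , y∈∩) with x∈p∩q⁻ (f a) _ y∈∩
    ... | y∈fa , y∈⋃ with x∈⋃-map⁻ f as y∈⋃
    ...   | b , b∈as , y∈fb = All.lookup a∉as b∈as (disjoint (here refl) (there b∈as) y∈fa y∈fb)

InL⇒InB0 : {t : ℕ} {θ : Fin t → Subset n} → InL θ φ → InB0 θ φ
InL⇒InB0 (gen a)    = gen a
InL⇒InB0 bot        = bot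
InL⇒InB0 top        = top
InL⇒InB0 (meet φ ψ) = meet (InL⇒InB0 φ) (InL⇒InB0 ψ)
InL⇒InB0 (join φ ψ) = join (InL⇒InB0 φ) (InL⇒InB0 ψ)

module IsBoxProperties {N t : ℕ} {θ : Fin t → Subset N} {□ : Subset N → Subset N}
  (isBox : IsBox θ □) where
  open IsBox isBox

  x∈□⊤ : x ∈ □ ⊤
  x∈□⊤ = subst (_ ∈_) (sym m-i) ∈⊤

  □-modusPonens : InB0 θ φ → InB0 θ ψ → x ∈ □ (∁ φ ∪ ψ) → x ∈ □ φ → x ∈ □ ψ
  □-modusPonens {φ} {ψ} φ∈B0 ψ∈B0 x∈□φ⇒ψ x∈□φ
    with x∈p∪q⁻ (∁ (□ φ)) (□ ψ) (m-ii φ ψ φ∈B0 ψ∈B0 x∈□φ⇒ψ)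
  ... | inj₁ x∈∁□φ = contradiction x∈□φ (x∈∁p⇒x∉p x∈∁□φ)
  ... | inj₂ x∈□ψ  = x∈□ψ

  □-mono : InB0 θ φ → InB0 θ ψ → φ ⊆ ψ → □ φ ⊆ □ ψ
  □-mono {φ} {ψ} φ∈B0 ψ∈B0 φ⊆ψ = □-modusPonens φ∈B0 ψ∈B0 x∈□φ⇒ψ
    where
    x∈□φ⇒ψ : ∀ {x} → x ∈ □ (∁ φ ∪ ψ)
    x∈□φ⇒ψ = subst (λ s → _ ∈ □ s) (⊆-antisym (λ _ → x∈∁p∪q φ⊆ψ) ⊆⊤) x∈□⊤

  □-∩ : InB0 θ φ → InB0 θ ψ → x ∈ □ φ → x ∈ □ ψ → x ∈ □ (φ ∩ ψ)
  □-∩ {φ} {ψ} φ∈B0 ψ∈B0 x∈□φ x∈□ψ =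
    □-modusPonens φ∈B0 φ∩ψ∈B0 (□-mono ψ∈B0 (join (neg φ∈B0) φ∩ψ∈B0) ψ⊆φ⇒φ∩ψ x∈□ψ) x∈□φ
    where
    φ∩ψ∈B0 : InB0 θ (φ ∩ ψ)
    φ∩ψ∈B0 = meet φ∈B0 ψ∈B0
    ψ⊆φ⇒φ∩ψ : ψ ⊆ ∁ φ ∪ (φ ∩ ψ)
    ψ⊆φ⇒φ∩ψ y∈ψ = x∈∁p∪q (λ y∈φ → x∈p∩q⁺ (y∈φ , y∈ψ))

module Enumerations {N t : ℕ} {θ : Fin t → Subset N} (decL : Decidable (InL θ)) where

  ∈Lbelow⇔ : ψ ∈ˡ Lbelow θ decL φ ⇔ (InL θ ψ × ψ ⊆ φ)
  ∈Lbelow⇔ = ∈-filter⇔ _ allSubsets-complete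

  ∈LstrictBelow⇔ : ψ ∈ˡ LstrictBelow θ decL φ ⇔ (InL θ ψ × ψ ⊂ φ)
  ∈LstrictBelow⇔ = ∈-filter⇔ _ allSubsets-complete

  ∈Lpairs⇔ : {η ξ : Subset N} → (η , ξ) ∈ˡ Lpairs θ decL φ ⇔ (InL θ η × InL θ ξ × η ∩ ξ ≡ φ)
  ∈Lpairs⇔ = ∈-filter⇔ _ λ (η , ξ) →
    ∈-cartesianProduct⁺ (allSubsets-complete η) (allSubsets-complete ξ)

  Lbelow-unique : Unique (Lbelow θ decL φ)
  Lbelow-unique = Unique.filter⁺ _ (allSubsets-unique N)

  LstrictBelow-unique : Unique (LstrictBelow θ decL φ)
  LstrictBelow-unique = Unique.filter⁺ _ (allSubsets-unique N)

  Lpairs-unique : Unique (Lpairs θ decL φ)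
  Lpairs-unique =
    Unique.filter⁺ _ (Unique.cartesianProduct⁺ (allSubsets-unique N) (allSubsets-unique N))

module Strongest {N t : ℕ} {θ : Fin t → Subset N} (decL : Decidable (InL θ))
  {□ : Subset N → Subset N} (isBox : IsBox θ □) where
  open IsBoxProperties isBox
  open Enumerations decL

  knownAt : Fin N → List (Subset N)
  knownAt x = filter (λ ψ → decL ψ ×-dec (x ∈? □ ψ)) (allSubsets N)

  strongest : Fin N → Subset N
  strongest x = ⋂ (knownAt x)

  ⋂-known : All (λ ψ → InL θ ψ × x ∈ □ ψ) ps → InL θ (⋂ ps) × x ∈ □ (⋂ ps)
  ⋂-known All.[]                   = top , x∈□⊤
  ⋂-known ((ψ∈L , x∈□ψ) All.∷ rest) with ⋂-known rest
  ... | ⋂∈L , x∈□⋂ = meet ψ∈L ⋂∈L , □-∩ (InL⇒InB0 ψ∈L) (InL⇒InB0 ⋂∈L) x∈□ψ x∈□⋂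

  strongest-∈L : (x : Fin N) → InL θ (strongest x)
  strongest-∈L x = proj₁ (⋂-known (all-filter _ (allSubsets N)))

  x∈□strongest : (x : Fin N) → x ∈ □ (strongest x)
  x∈□strongest x = proj₂ (⋂-known (all-filter _ (allSubsets N)))

  strongest-⊆ : InL θ ψ → x ∈ □ ψ → strongest x ⊆ ψ
  strongest-⊆ ψ∈L x∈□ψ = ⋂⊆ (∈-filter⁺ _ (allSubsets-complete _) (ψ∈L , x∈□ψ))

  x∈focal-strongest : (x : Fin N) → x ∈ focal θ decL □ (strongest x)
  x∈focal-strongest x = x∈p∩q⁺ (x∈□strongest x , x∉p⇒x∈∁p x∉□stronger)
    where
    x∉□stronger : x ∉ ⋃ (map □ (LstrictBelow θ decL (strongest x)))
    x∉□stronger x∈⋃ with x∈⋃-map⁻ □ _ x∈⋃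
    ... | ψ , ψ∈ , x∈□ψ with to ∈LstrictBelow⇔ ψ∈
    ...   | ψ∈L , ψ⊂s = ⊂-irref refl (⊂-⊆-trans ψ⊂s (strongest-⊆ ψ∈L x∈□ψ))

  ∈focal⇒≡strongest : InL θ φ → x ∈ focal θ decL □ φ → φ ≡ strongest x
  ∈focal⇒≡strongest {φ = φ} {x = x} φ∈L x∈focal with x∈p∩q⁻ (□ φ) _ x∈focal
  ... | x∈□φ , x∉□stronger with ⊆⇒⊂⊎≡ (strongest-⊆ φ∈L x∈□φ)
  ...   | inj₂ s≡φ = sym s≡φ
  ...   | inj₁ s⊂φ = contradiction x∈□stronger (x∈∁p⇒x∉p x∉□stronger)
    where
    x∈□stronger : x ∈ ⋃ (map □ (LstrictBelow θ decL φ))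
    x∈□stronger = x∈⋃-map⁺ (from ∈LstrictBelow⇔ (strongest-∈L x , s⊂φ)) (x∈□strongest x)

  strongest≡⇒∈focal : strongest x ≡ φ → x ∈ focal θ decL □ φ
  strongest≡⇒∈focal {x = x} refl = x∈focal-strongest x

  focal-disjoint : InL θ φ → InL θ ψ → x ∈ focal θ decL □ φ → x ∈ focal θ decL □ ψ → φ ≡ ψ
  focal-disjoint φ∈L ψ∈L x∈focalφ x∈focalψ =
    trans (∈focal⇒≡strongest φ∈L x∈focalφ) (sym (∈focal⇒≡strongest ψ∈L x∈focalψ))

  □≡⋃focal : InL θ φ → (∀ {ψ} → ψ ∈ˡ ps ⇔ (InL θ ψ × ψ ⊆ φ)) →
             □ φ ≡ ⋃ (map (focal θ decL □) ps)
  □≡⋃focal {φ = φ} {ps = ps} φ∈L ps⇔ = ⊆-antisym □φ⊆⋃ ⋃⊆□φ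
    where
    □φ⊆⋃ : □ φ ⊆ ⋃ (map (focal θ decL □) ps)
    □φ⊆⋃ {x} x∈□φ =
      x∈⋃-map⁺ (from ps⇔ (strongest-∈L x , strongest-⊆ φ∈L x∈□φ)) (x∈focal-strongest x)
    ⋃⊆□φ : ⋃ (map (focal θ decL □) ps) ⊆ □ φ
    ⋃⊆□φ x∈⋃ with x∈⋃-map⁻ (focal θ decL □) ps x∈⋃
    ... | ψ , ψ∈ps , x∈focalψ with to ps⇔ ψ∈ps
    ...   | ψ∈L , ψ⊆φ = □-mono (InL⇒InB0 ψ∈L) (InL⇒InB0 φ∈L) ψ⊆φ (p∩q⊆p (□ ψ) _ x∈focalψ)

  module _ {c ℓ : Level} (R : CommutativeRing c ℓ) {μ : Subset N → CommutativeRing.Carrier R}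
    (additive : IsAdditive R μ) where
    open CommutativeRing R hiding (refl; sym; trans)
    open AdditiveProperties R additive using (μ-⋃-disjoint)
    open import Algebra.Properties.Ring ring using (//-rightDividesʳ)
    open import Relation.Binary.Reasoning.Setoid setoid

    Bel≈Σmass : InL θ φ → Unique ps → (∀ {ψ} → ψ ∈ˡ ps ⇔ (InL θ ψ × ψ ⊆ φ)) →
                Bel θ decL R μ □ φ ≈ sumR R (mass θ decL R μ □) ps
    Bel≈Σmass {φ = φ} {ps = ps} φ∈L unique ps⇔ = begin
      μ (□ φ)                               ≡⟨ cong μ (□≡⋃focal φ∈L ps⇔) ⟩
      μ (⋃ (map (focal θ decL □) ps))       ≈⟨ μ-⋃-disjoint (focal θ decL □) ps unique disjoint ⟩
      sumR R (mass θ decL R μ □) ps         ∎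
      where
      disjoint : ∀ {ψ ψ′} {y : Fin N} → ψ ∈ˡ ps → ψ′ ∈ˡ ps →
                 y ∈ focal θ decL □ ψ → y ∈ focal θ decL □ ψ′ → ψ ≡ ψ′
      disjoint ψ∈ ψ′∈ = focal-disjoint (proj₁ (to ps⇔ ψ∈)) (proj₁ (to ps⇔ ψ′∈))

    Bel≈Σmass-Lbelow : InL θ φ → Bel θ decL R μ □ φ ≈ sumR R (mass θ decL R μ □) (Lbelow θ decL φ)
    Bel≈Σmass-Lbelow φ∈L = Bel≈Σmass φ∈L Lbelow-unique ∈Lbelow⇔

    mass≈Bel-ΣmassStrict : InL θ φ →
      mass θ decL R μ □ φ ≈ Bel θ decL R μ □ φ - sumR R (mass θ decL R μ □) (LstrictBelow θ decL φ)
    mass≈Bel-ΣmassStrict {φ = φ} φ∈L = begin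
      m              ≈⟨ //-rightDividesʳ s m ⟨
      (m + s) - s    ≈⟨ +-congʳ (Bel≈Σmass φ∈L unique ∈φ∷strict⇔) ⟨
      Bel θ decL R μ □ φ - s ∎
      where
      m s : Carrier
      m = mass θ decL R μ □ φ
      s = sumR R (mass θ decL R μ □) (LstrictBelow θ decL φ)
      unique : Unique (φ ∷ LstrictBelow θ decL φ)
      unique = All.tabulate (λ ψ∈ φ≡ψ → ⊂-irref (sym φ≡ψ) (proj₂ (to ∈LstrictBelow⇔ ψ∈)))
             ∷ LstrictBelow-unique
      ∈φ∷strict⇔ : ψ ∈ˡ φ ∷ LstrictBelow θ decL φ ⇔ (InL θ ψ × ψ ⊆ φ)
      ∈φ∷strict⇔ = mk⇔ ∈⇒ ⇒∈
        where
        ∈⇒ : ψ ∈ˡ φ ∷ LstrictBelow θ decL φ → InL θ ψ × ψ ⊆ φ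
        ∈⇒ (here refl) = φ∈L , ⊆-refl
        ∈⇒ (there ψ∈)  = let ψ∈L , ψ⊂φ = to ∈LstrictBelow⇔ ψ∈ in ψ∈L , p⊂q⇒p⊆q ψ⊂φ
        ⇒∈ : InL θ ψ × ψ ⊆ φ → ψ ∈ˡ φ ∷ LstrictBelow θ decL φ
        ⇒∈ (ψ∈L , ψ⊆φ) with ⊆⇒⊂⊎≡ ψ⊆φ
        ... | inj₁ ψ⊂φ = there (from ∈LstrictBelow⇔ (ψ∈L , ψ⊂φ))
        ... | inj₂ refl = here refl

module Joint {N t : ℕ} {θ : Fin t → Subset N} (decL : Decidable (InL θ))
  {box : Agent → Subset N → Subset N} (isBox : (k : Agent) → IsBox θ (box k))
  (i⊆ij : (φ : Subset N) → InB0 θ φ → box i φ ⊆ box ij φ)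
  (j⊆ij : (φ : Subset N) → InB0 θ φ → box j φ ⊆ box ij φ)
  (ij⊆i∪j : (φ : Subset N) → InB0 θ φ → box ij φ ⊆ (box i φ ∪ box j φ))
  where
  open Enumerations decL
  module I  = Strongest decL (isBox i)
  module J  = Strongest decL (isBox j)
  module IJ = Strongest decL (isBox ij)

  strongest-ij : (x : Fin N) → IJ.strongest x ≡ I.strongest x ∩ J.strongest x
  strongest-ij x = ⊆-antisym (IJ.strongest-⊆ ηξ∈L x∈□ijηξ) ηξ⊆
    where
    η∈L : InL θ (I.strongest x)
    η∈L = I.strongest-∈L x
    ξ∈L : InL θ (J.strongest x)
    ξ∈L = J.strongest-∈L x
    ηξ∈L : InL θ (I.strongest x ∩ J.strongest x)
    ηξ∈L = meet η∈L ξ∈L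
    x∈□ijηξ : x ∈ box ij (I.strongest x ∩ J.strongest x)
    x∈□ijηξ = IsBoxProperties.□-∩ (isBox ij) (InL⇒InB0 η∈L) (InL⇒InB0 ξ∈L)
                (i⊆ij _ (InL⇒InB0 η∈L) (I.x∈□strongest x))
                (j⊆ij _ (InL⇒InB0 ξ∈L) (J.x∈□strongest x))
    ηξ⊆ : I.strongest x ∩ J.strongest x ⊆ IJ.strongest x
    ηξ⊆ y∈ηξ with x∈p∪q⁻ _ _ (ij⊆i∪j _ (InL⇒InB0 (IJ.strongest-∈L x)) (IJ.x∈□strongest x))
    ... | inj₁ x∈□i = I.strongest-⊆ (IJ.strongest-∈L x) x∈□i (p∩q⊆p _ _ y∈ηξ)
    ... | inj₂ x∈□j = J.strongest-⊆ (IJ.strongest-∈L x) x∈□j (p∩q⊆q _ _ y∈ηξ)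

  pairFocal : Subset N × Subset N → Subset N
  pairFocal (η , ξ) = focal θ decL (box i) η ∩ focal θ decL (box j) ξ

  x∈pairFocal⇒≡strongest : {η ξ : Subset N} → InL θ η → InL θ ξ →
    x ∈ pairFocal (η , ξ) → (η , ξ) ≡ (I.strongest x , J.strongest x)
  x∈pairFocal⇒≡strongest {η = η} η∈L ξ∈L x∈ with x∈p∩q⁻ (focal θ decL (box i) η) _ x∈
  ... | x∈focalη , x∈focalξ =
    cong₂ _,_ (I.∈focal⇒≡strongest η∈L x∈focalη) (J.∈focal⇒≡strongest ξ∈L x∈focalξ)

  focal-ij≡⋃pairFocal : InL θ φ → focal θ decL (box ij) φ ≡ ⋃ (map pairFocal (Lpairs θ decL φ))
  focal-ij≡⋃pairFocal {φ = φ} φ∈L = ⊆-antisym focal⊆⋃ ⋃⊆focal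
    where
    focal⊆⋃ : focal θ decL (box ij) φ ⊆ ⋃ (map pairFocal (Lpairs θ decL φ))
    focal⊆⋃ {x} x∈focal = x∈⋃-map⁺ strongestPair∈Lpairs
      (x∈p∩q⁺ (I.x∈focal-strongest x , J.x∈focal-strongest x))
      where
      strongestPair∈Lpairs : (I.strongest x , J.strongest x) ∈ˡ Lpairs θ decL φ
      strongestPair∈Lpairs = from ∈Lpairs⇔ (I.strongest-∈L x , J.strongest-∈L x ,
        trans (sym (strongest-ij x)) (sym (IJ.∈focal⇒≡strongest φ∈L x∈focal)))
    ⋃⊆focal : ⋃ (map pairFocal (Lpairs θ decL φ)) ⊆ focal θ decL (box ij) φ
    ⋃⊆focal {x} x∈⋃ with x∈⋃-map⁻ pairFocal _ x∈⋃
    ... | (η , ξ) , ηξ∈ , x∈pairFocal with to ∈Lpairs⇔ ηξ∈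
    ...   | η∈L , ξ∈L , η∩ξ≡φ with x∈pairFocal⇒≡strongest η∈L ξ∈L x∈pairFocal
    ...     | refl = IJ.strongest≡⇒∈focal (trans (strongest-ij x) η∩ξ≡φ)

  module _ {c ℓ : Level} (R : CommutativeRing c ℓ) {μ : Subset N → CommutativeRing.Carrier R}
    (additive : IsAdditive R μ) where
    open CommutativeRing R hiding (refl; sym; trans)
    open AdditiveProperties R additive using (μ-⋃-disjoint)
    open import Relation.Binary.Reasoning.Setoid setoid

    mass-ij≈ΣpairFocal : InL θ φ →
      mass θ decL R μ (box ij) φ ≈ sumR R (μ ∘ pairFocal) (Lpairs θ decL φ)
    mass-ij≈ΣpairFocal {φ = φ} φ∈L = begin
      μ (focal θ decL (box ij) φ)               ≡⟨ cong μ (focal-ij≡⋃pairFocal φ∈L) ⟩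
      μ (⋃ (map pairFocal (Lpairs θ decL φ)))   ≈⟨ μ-⋃-disjoint pairFocal _ Lpairs-unique disjoint ⟩
      sumR R (μ ∘ pairFocal) (Lpairs θ decL φ)  ∎
      where
      disjoint : ∀ {q q′} {y : Fin N} → q ∈ˡ Lpairs θ decL φ → q′ ∈ˡ Lpairs θ decL φ →
                 y ∈ pairFocal q → y ∈ pairFocal q′ → q ≡ q′
      disjoint {η , ξ} {η′ , ξ′} q∈ q′∈ y∈q y∈q′ with to ∈Lpairs⇔ q∈ | to ∈Lpairs⇔ q′∈
      ... | η∈L , ξ∈L , _ | η′∈L , ξ′∈L , _ =
        trans (x∈pairFocal⇒≡strongest η∈L ξ∈L y∈q) (sym (x∈pairFocal⇒≡strongest η′∈L ξ′∈L y∈q′))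

mainTheorem9 : {c ℓ ℓ' : Level} (R : CommutativeRing c ℓ)
    (_≤_ : CommutativeRing.Carrier R → CommutativeRing.Carrier R → Set ℓ')
    {N t : ℕ} (θ : Fin t → Subset N) (decL : Decidable (InL θ))
    (box : Agent → Subset N → Subset N) →
    ((k : Agent) → IsBox θ (box k)) →
    ((φ : Subset N) → InB0 θ φ → box i φ ⊆ box ij φ) →
    ((φ : Subset N) → InB0 θ φ → box j φ ⊆ box ij φ) →
    ((φ : Subset N) → InB0 θ φ → box ij φ ⊆ (box i φ ∪ box j φ)) →
    (p : Subset N → CommutativeRing.Carrier R) → IsProbability R _≤_ p →
    (φ : Subset N) → InL θ φ →
    let open CommutativeRing R in
    ((k : Agent) →
      (Bel θ decL R p (box k) φ ≈ sumR R (mass θ decL R p (box k)) (Lbelow θ decL φ))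
      × (mass θ decL R p (box k) φ
          ≈ Bel θ decL R p (box k) φ - sumR R (mass θ decL R p (box k)) (LstrictBelow θ decL φ)))
    × (mass θ decL R p (box ij) φ
        ≈ sumR R (λ q → let (η , ξ) = q in p (focal θ decL (box i) η ∩ focal θ decL (box j) ξ))
                 (Lpairs θ decL φ))
mainTheorem9 R _ θ decL box isBox i⊆ij j⊆ij ij⊆i∪j p isProbability φ φ∈L =
  (λ k → let open Strongest decL (isBox k) in
         Bel≈Σmass-Lbelow R additive φ∈L , mass≈Bel-ΣmassStrict R additive φ∈L) ,
  Joint.mass-ij≈ΣpairFocal decL isBox i⊆ij j⊆ij ij⊆i∪j R additive φ∈L
  where open IsProbability isProbability using (additive)
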